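{- If $D$ is a strongly connected bipartite digraph and $D$ is not the biorientation $\overleftrightarrow{K_2}$ of $K_2$, then $\overrightarrow{pc}(D)=2$.
   Context: All digraphs are finite, loopless, without parallel arcs (opposite arcs are allowed). A digraph is bipartite if its vertex set can be partitioned into two independent sets (no arc has both ends in the same set). A digraph is strongly connected if for every ordered pair $(u,v)$ of vertices there is a directed $uv$-path. $\overleftrightarrow{K_2}$ is the digraph on two vertices $u,v$ with arcs $uv$ and $vu$. A directed path in an arc-coloured digraph is properly coloured if no two consecutive arcs on it have the same colour. An arc-colouring of $D$ makes $D$ properly connected if for every ordered pair $(u,v)$ of distinct vertices there is a properly coloured directed $uv$-path; $\overrightarrow{pc}(D)$ is the minimum number of colours in such an arc-colouring. -}

module Defs where

open import Data.Nat using (ℕ)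
open import Data.Fin using (Fin)
open import Data.Bool using (Bool; T)
open import Data.List using (List; []; _∷_)
open import Data.List.Relation.Unary.Unique.Propositional using (Unique)
open import Data.List.Membership.Propositional using (_∈_)
open import Data.List.Relation.Unary.Any using (here; there)
open import Data.Product using (Σ; ∃; _×_; ∃-syntax)
open import Data.Sum using (_⊎_)
open import Data.Unit using (⊤)
open import Relation.Binary.PropositionalEquality using (_≡_; _≢_)

-- A finite digraph on vertex set Fin n.  Arcs are given by a Boolean
-- adjacency relation (so there are no parallel arcs; opposite arcs are
-- allowed), and there are no loops.
record Digraph : Set where
  field
    n        : ℕ
    arc      : Fin n → Fin n → Bool
    loopless : ∀ v → arc v v ≡ Data.Bool.false

open Digraph public

Arc : (D : Digraph) → Fin (n D) → Fin (n D) → Set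
Arc D u v = T (arc D u v)

lastOf : ∀ {A : Set} → A → List A → A
lastOf x []       = x
lastOf _ (y ∷ ys) = lastOf y ys

IsWalk : (D : Digraph) → List (Fin (n D)) → Set
IsWalk D []            = ⊤
IsWalk D (x ∷ [])      = ⊤
IsWalk D (x ∷ y ∷ xs)  = Arc D x y × IsWalk D (y ∷ xs)

record Path (D : Digraph) (u v : Fin (n D)) : Set where
  constructor mkPath
  field
    rest     : List (Fin (n D))
    ends     : lastOf u rest ≡ v
    distinct : Unique (u ∷ rest)
    walk     : IsWalk D (u ∷ rest)

-- An arc-colouring with k colours (only its values on arcs matter).
Colouring : Digraph → ℕ → Set
Colouring D k = Fin (n D) → Fin (n D) → Fin k

ProperlyColouredSeq : ∀ {D : Digraph} {k : ℕ} → Colouring D k → List (Fin (n D)) → Set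
ProperlyColouredSeq c []               = ⊤
ProperlyColouredSeq c (x ∷ [])         = ⊤
ProperlyColouredSeq c (x ∷ y ∷ [])     = ⊤
ProperlyColouredSeq {D} {k} c (x ∷ y ∷ z ∷ xs) =
  c x y ≢ c y z × ProperlyColouredSeq {D} {k} c (y ∷ z ∷ xs)

ProperlyColouredPath : ∀ {D : Digraph} {k : ℕ} {u v : Fin (n D)} → Colouring D k → Path D u v → Set
ProperlyColouredPath {D} {k} {u} c p = ProperlyColouredSeq {D} {k} c (u ∷ Path.rest p)

ProperlyConnecting : (D : Digraph) {k : ℕ} → Colouring D k → Set
ProperlyConnecting D {k} c =
  ∀ u v → u ≢ v → Σ (Path D u v) (λ p → ProperlyColouredPath {D} {k} {u} {v} c p)

PC≡ : Digraph → ℕ → Set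
PC≡ D m = (Σ (Colouring D m) (ProperlyConnecting D))
        × (∀ k → (c : Colouring D k) → ProperlyConnecting D c → m Data.Nat.≤ k)

StronglyConnected : Digraph → Set
StronglyConnected D = ∀ u v → Path D u v

Bipartite : Digraph → Set
Bipartite D = Σ (Fin (n D) → Bool) (λ side → ∀ u v → Arc D u v → side u ≢ side v)

IsBiorientedK2 : Digraph → Set
IsBiorientedK2 D =
  Σ (Fin (n D)) λ a → Σ (Fin (n D)) λ b → (a ≢ b × (∀ w → w ≡ a ⊎ w ≡ b) × Arc D a b × Arc D b a)

-- Colouring every arc by the side of its tail is proper along every walk, since
-- consecutive arcs start on opposite sides; strong connectivity then gives
-- pc(D) ≤ 2.  With one colour a properly coloured path has a single arc, so a
-- properly connected digraph would be complete.  But among three vertices of a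
-- bipartite digraph two lie on the same side, and a complete digraph on two
-- vertices is the biorientation of K₂; hence pc(D) ≥ 2.
module Submission where

open import Defs
open import Data.Bool using (Bool; true; false)
open import Data.Empty using (⊥-elim)
open import Data.Fin using (Fin; zero; suc)
open import Data.Fin.Properties using (¬Fin0)
open import Data.List using ([]; _∷_)
open import Data.Nat using (_≤_; zero; suc; z≤n; s≤s)
open import Data.Nat.Properties using (m≤n⇒m<n∨m≡n)
open import Data.Product using (_,_)
open import Data.Sum using (_⊎_; inj₁; inj₂)
open import Data.Unit using (tt)
open import Relation.Binary.PropositionalEquality using (_≡_; _≢_; refl; sym; subst)
open import Relation.Nullary using (¬_)

Complete : Digraph → Set
Complete D = ∀ u v → u ≢ v → Arc D u v

Bool-pigeonhole : (a b c : Bool) → a ≡ b ⊎ a ≡ c ⊎ b ≡ c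
Bool-pigeonhole false false _     = inj₁ refl
Bool-pigeonhole true  true  _     = inj₁ refl
Bool-pigeonhole false true  false = inj₂ (inj₁ refl)
Bool-pigeonhole true  false true  = inj₂ (inj₁ refl)
Bool-pigeonhole false true  true  = inj₂ (inj₂ refl)
Bool-pigeonhole true  false false = inj₂ (inj₂ refl)

bipartite⇒¬complete : (D : Digraph) → 3 ≤ n D → Bipartite D → ¬ Complete D
bipartite⇒¬complete record { n = suc (suc (suc _)) } (s≤s (s≤s (s≤s _)))
                    (side , bipartite) complete
  with Bool-pigeonhole (side zero) (side (suc zero)) (side (suc (suc zero)))
... | inj₁ eq        = bipartite _ _ (complete _ _ (λ ())) eq
... | inj₂ (inj₁ eq) = bipartite _ _ (complete _ _ (λ ())) eq
... | inj₂ (inj₂ eq) = bipartite _ _ (complete _ _ (λ ())) eq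

complete⇒biorientedK2 : (D : Digraph) → n D ≡ 2 → Complete D → IsBiorientedK2 D
complete⇒biorientedK2 record { n = .2 } refl complete =
  zero , suc zero , (λ ()) , Fin2-cases , complete _ _ (λ ()) , complete _ _ (λ ())
  where
  Fin2-cases : ∀ (w : Fin 2) → w ≡ zero ⊎ w ≡ suc zero
  Fin2-cases zero       = inj₁ refl
  Fin2-cases (suc zero) = inj₂ refl

sideColour : Bool → Fin 2
sideColour false = zero
sideColour true  = suc zero

sideColour-injective : ∀ {a b} → a ≢ b → sideColour a ≢ sideColour b
sideColour-injective {false} {false} a≢b _ = a≢b refl
sideColour-injective {true}  {true}  a≢b _ = a≢b refl
sideColour-injective {false} {true}  _   ()
sideColour-injective {true}  {false} _   ()

sideColouring : (D : Digraph) → (Fin (n D) → Bool) → Colouring D 2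
sideColouring D side u _ = sideColour (side u)

sideColouring-properOnWalks : (D : Digraph) ((side , _) : Bipartite D) →
  ∀ xs → IsWalk D xs → ProperlyColouredSeq {D} (sideColouring D side) xs
sideColouring-properOnWalks D _ []          _ = tt
sideColouring-properOnWalks D _ (_ ∷ [])     _ = tt
sideColouring-properOnWalks D _ (_ ∷ _ ∷ []) _ = tt
sideColouring-properOnWalks D (side , bipartite) (x ∷ y ∷ z ∷ xs) (xy , walk) =
  sideColour-injective (bipartite x y xy)
  , sideColouring-properOnWalks D (side , bipartite) (y ∷ z ∷ xs) walk

sideColouring-properlyConnecting : (D : Digraph) → StronglyConnected D →
  ((side , _) : Bipartite D) → ProperlyConnecting D (sideColouring D side)
sideColouring-properlyConnecting D connected (side , bipartite) u v _ =
  let p = connected u v in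
  p , sideColouring-properOnWalks D (side , bipartite) (u ∷ Path.rest p) (Path.walk p)

properlyConnecting₁⇒complete : (D : Digraph) (c : Colouring D 1) →
  ProperlyConnecting D c → Complete D
properlyConnecting₁⇒complete D c connecting u v u≢v with connecting u v u≢v
... | mkPath []          u≡v _ _        , _ = ⊥-elim (u≢v u≡v)
... | mkPath (y ∷ [])    y≡v _ (uy , _) , _ = subst (Arc D u) y≡v uy
... | mkPath (y ∷ z ∷ _) _   _ _        , (differ , _) with c u y | c y z
...   | zero | zero = ⊥-elim (differ refl)

¬complete⇒2≤colours : (D : Digraph) → ¬ Complete D →
  ∀ k (c : Colouring D k) → ProperlyConnecting D c → 2 ≤ k
¬complete⇒2≤colours D incomplete zero c _ =
  ⊥-elim (incomplete λ u v _ → ⊥-elim (¬Fin0 (c u v)))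
¬complete⇒2≤colours D incomplete (suc zero) c connecting =
  ⊥-elim (incomplete (properlyConnecting₁⇒complete D c connecting))
¬complete⇒2≤colours D _ (suc (suc _)) _ _ = s≤s (s≤s z≤n)

proposition1 : (D : Digraph) → 2 ≤ n D → StronglyConnected D → Bipartite D
    → ¬ IsBiorientedK2 D → PC≡ D 2
proposition1 D 2≤n connected bipartite@(side , _) ¬K2 =
  (sideColouring D side , sideColouring-properlyConnecting D connected bipartite)
  , ¬complete⇒2≤colours D incomplete
  where
  incomplete : ¬ Complete D
  incomplete with m≤n⇒m<n∨m≡n 2≤n
  ... | inj₁ 3≤n = bipartite⇒¬complete D 3≤n bipartite
  ... | inj₂ 2≡n = λ complete → ¬K2 (complete⇒biorientedK2 D (sym 2≡n) complete)
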